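{- Let $\langle\mathbf{A},\forall,\exists\rangle$ be an Epistemic BL-algebra whose BL-reduct $\mathbf{A}$ is a Gödel algebra. Then for all $a,b\in A$: (G1) $\forall(a\ast b)=\forall a\ast\forall b$; (G2) $\forall 1=1$; (G3) $\exists a\to\forall b\le\forall(a\to b)$; (G4) $\exists(a\vee b)=\exists a\vee\exists b$; (G5) $\exists 0=0$; (G6) $\exists(a\to b)\le\forall a\to\exists b$; (G7) $\forall a\le\exists a$; (G8) $\forall a\le\forall\forall a$ and $\exists a\le\exists\exists a$; (G9) $\exists a\le\forall\exists a$ and $\exists\forall a\le\forall a$. That is, $\langle\mathbf{A},\forall,\exists\rangle$ is a bi-modal Gödel algebra.
   Context: A BL-algebra is an algebra $\langle A,\wedge,\vee,\ast,\to,0,1\rangle$ such that $\langle A,\wedge,\vee,0,1\rangle$ is a bounded lattice (order $\le$), $\langle A,\ast,1\rangle$ is a commutative monoid, $a\ast b\le c$ iff $a\le b\to c$, and $a\wedge b=a\ast(a\to b)$ and $(a\to b)\vee(b\to a)=1$ hold. A Gödel algebra is a BL-algebra satisfying $a\ast b=a\wedge b$. An Epistemic BL-algebra is a BL-algebra with unary operations $\forall,\exists$ satisfying, for all $a,b$: $\forall 1=1$; $\exists 0=0$; $\forall a\to\exists a=1$; $\forall(a\to\forall b)=\exists a\to\forall b$; $\forall(\forall a\to b)=\forall a\to\forall b$; $\exists a\to\forall\exists a=1$; $\forall(a\wedge b)=\forall a\wedge\forall b$; $\exists(a\vee b)=\exists a\vee\exists b$; $\exists(a\ast\exists b)=\exists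 a\ast\exists b$. A bi-modal Gödel algebra is a Gödel algebra with unary operations $\forall,\exists$ satisfying (G1)–(G9) as listed in the claim. -}

module Defs where

open import Level using (Level; suc)
open import Relation.Binary.PropositionalEquality using (_≡_)

record BLAlgebra (c : Level) : Set (suc c) where
  infixr 6 _∨_
  infixr 7 _∧_
  infixr 7 _∗_
  infixr 5 _⇒_
  infix 4 _≤_
  field
    A   : Set c
    _∧_ : A → A → A
    _∨_ : A → A → A
    _∗_ : A → A → A
    _⇒_ : A → A → A
    𝟘   : A
    𝟙   : A

  _≤_ : A → A → Set c
  a ≤ b = a ∧ b ≡ a

  field
    ∧-comm   : ∀ a b → a ∧ b ≡ b ∧ a
    ∨-comm   : ∀ a b → a ∨ b ≡ b ∨ a
    ∧-assoc  : ∀ a b c → (a ∧ b) ∧ c ≡ a ∧ (b ∧ c)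
    ∨-assoc  : ∀ a b c → (a ∨ b) ∨ c ≡ a ∨ (b ∨ c)
    ∧-absorb : ∀ a b → a ∧ (a ∨ b) ≡ a
    ∨-absorb : ∀ a b → a ∨ (a ∧ b) ≡ a
    𝟘-least  : ∀ a → 𝟘 ≤ a
    𝟙-greatest : ∀ a → a ≤ 𝟙
    ∗-comm   : ∀ a b → a ∗ b ≡ b ∗ a
    ∗-assoc  : ∀ a b c → (a ∗ b) ∗ c ≡ a ∗ (b ∗ c)
    ∗-identityʳ : ∀ a → a ∗ 𝟙 ≡ a
    residuation₁ : ∀ a b c → a ∗ b ≤ c → a ≤ b ⇒ c
    residuation₂ : ∀ a b c → a ≤ b ⇒ c → a ∗ b ≤ c
    divisibility : ∀ a b → a ∧ b ≡ a ∗ (a ⇒ b)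
    prelinearity : ∀ a b → (a ⇒ b) ∨ (b ⇒ a) ≡ 𝟙

IsGödel : ∀ {c} → BLAlgebra c → Set c
IsGödel B = ∀ a b → a ∗ b ≡ a ∧ b
  where open BLAlgebra B

-- Epistemic BL-algebra axioms for unary ∀,∃ on a BL-algebra.
record IsEpistemic {c} (B : BLAlgebra c) (□ ◇ : BLAlgebra.A B → BLAlgebra.A B) : Set c where
  open BLAlgebra B
  field
    E1 : □ 𝟙 ≡ 𝟙
    E2 : ◇ 𝟘 ≡ 𝟘
    E3 : ∀ a → □ a ⇒ ◇ a ≡ 𝟙
    E4 : ∀ a b → □ (a ⇒ □ b) ≡ ◇ a ⇒ □ b
    E5 : ∀ a b → □ (□ a ⇒ b) ≡ □ a ⇒ □ b
    E6 : ∀ a → ◇ a ⇒ □ (◇ a) ≡ 𝟙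
    E7 : ∀ a b → □ (a ∧ b) ≡ □ a ∧ □ b
    E8 : ∀ a b → ◇ (a ∨ b) ≡ ◇ a ∨ ◇ b
    E9 : ∀ a b → ◇ (a ∗ ◇ b) ≡ ◇ a ∗ ◇ b

record IsBiModalGödel {c} (B : BLAlgebra c) (□ ◇ : BLAlgebra.A B → BLAlgebra.A B) : Set c where
  open BLAlgebra B
  field
    G1  : ∀ a b → □ (a ∗ b) ≡ □ a ∗ □ b
    G2  : □ 𝟙 ≡ 𝟙
    G3  : ∀ a b → ◇ a ⇒ □ b ≤ □ (a ⇒ b)
    G4  : ∀ a b → ◇ (a ∨ b) ≡ ◇ a ∨ ◇ b
    G5  : ◇ 𝟘 ≡ 𝟘
    G6  : ∀ a b → ◇ (a ⇒ b) ≤ □ a ⇒ ◇ b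
    G7  : ∀ a → □ a ≤ ◇ a
    G8a : ∀ a → □ a ≤ □ (□ a)
    G8b : ∀ a → ◇ a ≤ ◇ (◇ a)
    G9a : ∀ a → ◇ a ≤ □ (◇ a)
    G9b : ∀ a → ◇ (□ a) ≤ □ a

-- From □ 𝟙 ≡ 𝟙 ≤ ◇ 𝟙 and E9, ◇ is idempotent, and with E3 and E6 every ◇ a is a
-- fixed point of □; hence □ a ⇒ ◇ b is □-closed.  By E4, ◇ c lies below a
-- □-closed d as soon as □ (c ⇒ d) ≡ 𝟙, which reduces G6 to the inequality
-- (□ a ⇒ a) ∧ (b ⇒ ◇ b) ≤ (a ⇒ b) ⇒ □ a ⇒ ◇ b, whose left side has □ equal to 𝟙.
-- In a Gödel algebra ∗ is ∧, so residuation and modus ponens hold for ∧; this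
-- gives that inequality as well as G1 and G3.
module Submission where

open import Level using (Level)
open import Relation.Binary.PropositionalEquality
open import Defs

module BLProperties {c : Level} (B : BLAlgebra c) where
  open BLAlgebra B

  ∧-idem : ∀ a → a ∧ a ≡ a
  ∧-idem a = trans (cong (a ∧_) (sym (∨-absorb a a))) (∧-absorb a (a ∧ a))

  ≤-refl : ∀ {a} → a ≤ a
  ≤-refl {a} = ∧-idem a

  ≤-reflexive : ∀ {a b} → a ≡ b → a ≤ b
  ≤-reflexive refl = ≤-refl

  ≤-trans : ∀ {a b d} → a ≤ b → b ≤ d → a ≤ d
  ≤-trans {a} {b} {d} a≤b b≤d =
    trans (cong (_∧ d) (sym a≤b)) (trans (∧-assoc a b d) (trans (cong (a ∧_) b≤d) a≤b))

  ≤-antisym : ∀ {a b} → a ≤ b → b ≤ a → a ≡ b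
  ≤-antisym {a} {b} a≤b b≤a = trans (sym a≤b) (trans (∧-comm a b) b≤a)

  x∧y≤x : ∀ {a b} → a ∧ b ≤ a
  x∧y≤x {a} {b} = begin
    (a ∧ b) ∧ a  ≡⟨ ∧-assoc a b a ⟩
    a ∧ (b ∧ a)  ≡⟨ cong (a ∧_) (∧-comm b a) ⟩
    a ∧ (a ∧ b)  ≡⟨ sym (∧-assoc a a b) ⟩
    (a ∧ a) ∧ b  ≡⟨ cong (_∧ b) (∧-idem a) ⟩
    a ∧ b        ∎
    where open ≡-Reasoning

  x∧y≤y : ∀ {a b} → a ∧ b ≤ b
  x∧y≤y {a} {b} = trans (cong (_∧ b) (∧-comm a b)) (trans x∧y≤x (∧-comm b a))

  ∧-greatest : ∀ {x a b} → x ≤ a → x ≤ b → x ≤ a ∧ b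
  ∧-greatest {x} {a} {b} x≤a x≤b = trans (sym (∧-assoc x a b)) (trans (cong (_∧ b) x≤a) x≤b)

  𝟙≤⇒≡𝟙 : ∀ {a} → 𝟙 ≤ a → a ≡ 𝟙
  𝟙≤⇒≡𝟙 {a} 𝟙≤a = trans (sym (𝟙-greatest a)) (trans (∧-comm a 𝟙) 𝟙≤a)

  𝟙∗x≡x : ∀ a → 𝟙 ∗ a ≡ a
  𝟙∗x≡x a = trans (∗-comm 𝟙 a) (∗-identityʳ a)

  ≤⇒⇒≡𝟙 : ∀ {a b} → a ≤ b → a ⇒ b ≡ 𝟙
  ≤⇒⇒≡𝟙 {a} {b} a≤b = 𝟙≤⇒≡𝟙 (residuation₁ 𝟙 a b (subst (_≤ b) (sym (𝟙∗x≡x a)) a≤b))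

  ⇒≡𝟙⇒≤ : ∀ {a b} → a ⇒ b ≡ 𝟙 → a ≤ b
  ⇒≡𝟙⇒≤ {a} {b} a⇒b≡𝟙 =
    subst (_≤ b) (𝟙∗x≡x a) (residuation₂ 𝟙 a b (subst (𝟙 ≤_) (sym a⇒b≡𝟙) ≤-refl))

module GödelProperties {c : Level} (B : BLAlgebra c) (gödel : IsGödel B) where
  open BLAlgebra B
  open BLProperties B

  ∧-residual₁ : ∀ {a b d} → a ∧ b ≤ d → a ≤ b ⇒ d
  ∧-residual₁ {a} {b} {d} a∧b≤d = residuation₁ a b d (subst (_≤ d) (sym (gödel a b)) a∧b≤d)

  ∧-residual₂ : ∀ {a b d} → a ≤ b ⇒ d → a ∧ b ≤ d
  ∧-residual₂ {a} {b} {d} a≤b⇒d = subst (_≤ d) (gödel a b) (residuation₂ a b d a≤b⇒d)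

  modus-ponens : ∀ {x p q} → x ≤ p → x ≤ p ⇒ q → x ≤ q
  modus-ponens {x} {p} {q} x≤p x≤p⇒q = ≤-trans (∧-greatest x≤p x≤p⇒q)
    (subst (_≤ q) (∧-comm (p ⇒ q) p) (∧-residual₂ ≤-refl))

  ⇒-trans : ∀ {p q r} → (p ⇒ q) ∧ (q ⇒ r) ≤ p ⇒ r
  ⇒-trans = ∧-residual₁ (modus-ponens (modus-ponens x∧y≤y (≤-trans x∧y≤x x∧y≤x))
                                      (≤-trans x∧y≤x x∧y≤y))

module EpistemicProperties {c : Level} (B : BLAlgebra c) (□ ◇ : BLAlgebra.A B → BLAlgebra.A B)
       (epistemic : IsEpistemic B □ ◇) where
  open BLAlgebra B
  open BLProperties B
  open IsEpistemic epistemic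

  □-mono : ∀ {a b} → a ≤ b → □ a ≤ □ b
  □-mono {a} {b} a≤b = trans (sym (E7 a b)) (cong □ a≤b)

  □≤◇ : ∀ a → □ a ≤ ◇ a
  □≤◇ a = ⇒≡𝟙⇒≤ (E3 a)

  ◇≤□◇ : ∀ a → ◇ a ≤ □ (◇ a)
  ◇≤□◇ a = ⇒≡𝟙⇒≤ (E6 a)

  ◇𝟙≡𝟙 : ◇ 𝟙 ≡ 𝟙
  ◇𝟙≡𝟙 = 𝟙≤⇒≡𝟙 (subst (_≤ ◇ 𝟙) E1 (□≤◇ 𝟙))

  ◇-idem : ∀ a → ◇ (◇ a) ≡ ◇ a
  ◇-idem a = begin
    ◇ (◇ a)        ≡⟨ cong ◇ (sym (𝟙∗x≡x (◇ a))) ⟩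
    ◇ (𝟙 ∗ ◇ a)    ≡⟨ E9 𝟙 a ⟩
    ◇ 𝟙 ∗ ◇ a      ≡⟨ cong (_∗ ◇ a) ◇𝟙≡𝟙 ⟩
    𝟙 ∗ ◇ a        ≡⟨ 𝟙∗x≡x (◇ a) ⟩
    ◇ a            ∎
    where open ≡-Reasoning

  □◇≡◇ : ∀ a → □ (◇ a) ≡ ◇ a
  □◇≡◇ a = ≤-antisym (≤-trans (□≤◇ (◇ a)) (≤-reflexive (◇-idem a))) (◇≤□◇ a)

  □-⇒-refl : ∀ a → □ (a ⇒ a) ≡ 𝟙
  □-⇒-refl a = trans (cong □ (≤⇒⇒≡𝟙 ≤-refl)) E1

  □≤□□ : ∀ a → □ a ≤ □ (□ a)
  □≤□□ a = ⇒≡𝟙⇒≤ (trans (sym (E5 a (□ a))) (□-⇒-refl (□ a)))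

  ◇□≤□ : ∀ a → ◇ (□ a) ≤ □ a
  ◇□≤□ a = ⇒≡𝟙⇒≤ (trans (sym (E4 (□ a) a)) (□-⇒-refl (□ a)))

  □[□x⇒x]≡𝟙 : ∀ a → □ (□ a ⇒ a) ≡ 𝟙
  □[□x⇒x]≡𝟙 a = trans (E5 a a) (≤⇒⇒≡𝟙 ≤-refl)

  □[x⇒◇x]≡𝟙 : ∀ a → □ (a ⇒ ◇ a) ≡ 𝟙
  □[x⇒◇x]≡𝟙 a = trans (cong (λ t → □ (a ⇒ t)) (sym (□◇≡◇ a))) (trans (E4 a (◇ a)) (E6 a))

  □-∧-≡𝟙 : ∀ {a b} → □ a ≡ 𝟙 → □ b ≡ 𝟙 → □ (a ∧ b) ≡ 𝟙
  □-∧-≡𝟙 {a} {b} □a≡𝟙 □b≡𝟙 = trans (E7 a b) (trans (cong₂ _∧_ □a≡𝟙 □b≡𝟙) (∧-idem 𝟙))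

  □-⇒-□◇ : ∀ a b → □ (□ a ⇒ ◇ b) ≡ □ a ⇒ ◇ b
  □-⇒-□◇ a b = trans (E5 a (◇ b)) (cong (□ a ⇒_) (□◇≡◇ b))

  ◇-≤-□-closed : ∀ {f x d} → □ f ≡ 𝟙 → f ≤ x ⇒ d → □ d ≡ d → ◇ x ≤ d
  ◇-≤-□-closed {f} {x} {d} □f≡𝟙 f≤x⇒d □d≡d = ⇒≡𝟙⇒≤ (begin
    ◇ x ⇒ d        ≡⟨ cong (◇ x ⇒_) (sym □d≡d) ⟩
    ◇ x ⇒ □ d      ≡⟨ sym (E4 x d) ⟩
    □ (x ⇒ □ d)    ≡⟨ cong (λ t → □ (x ⇒ t)) □d≡d ⟩
    □ (x ⇒ d)      ≡⟨ 𝟙≤⇒≡𝟙 (subst (_≤ □ (x ⇒ d)) □f≡𝟙 (□-mono f≤x⇒d)) ⟩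
    𝟙              ∎)
    where open ≡-Reasoning

module EpistemicGödelProperties {c : Level} (B : BLAlgebra c) (□ ◇ : BLAlgebra.A B → BLAlgebra.A B)
       (gödel : IsGödel B) (epistemic : IsEpistemic B □ ◇) where
  open BLAlgebra B
  open BLProperties B
  open GödelProperties B gödel
  open EpistemicProperties B □ ◇ epistemic
  open IsEpistemic epistemic

  □-∗ : ∀ a b → □ (a ∗ b) ≡ □ a ∗ □ b
  □-∗ a b = trans (cong □ (gödel a b)) (trans (E7 a b) (sym (gödel (□ a) (□ b))))

  ◇⇒□≤□⇒ : ∀ a b → ◇ a ⇒ □ b ≤ □ (a ⇒ b)
  ◇⇒□≤□⇒ a b = subst (_≤ □ (a ⇒ b)) □-of-premises (□-mono ⇒-trans)
    where
    □-of-premises : □ ((a ⇒ □ b) ∧ (□ b ⇒ b)) ≡ ◇ a ⇒ □ b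
    □-of-premises = trans (E7 (a ⇒ □ b) (□ b ⇒ b))
      (trans (cong₂ _∧_ (E4 a b) (□[□x⇒x]≡𝟙 b)) (𝟙-greatest _))

  ◇⇒≤□⇒◇ : ∀ a b → ◇ (a ⇒ b) ≤ □ a ⇒ ◇ b
  ◇⇒≤□⇒◇ a b = ◇-≤-□-closed (□-∧-≡𝟙 (□[□x⇒x]≡𝟙 a) (□[x⇒◇x]≡𝟙 b))
                            (∧-residual₁ (∧-residual₁ x≤◇b)) (□-⇒-□◇ a b)
    where
    x : A
    x = (((□ a ⇒ a) ∧ (b ⇒ ◇ b)) ∧ (a ⇒ b)) ∧ □ a
    x≤a : x ≤ a
    x≤a = modus-ponens x∧y≤y (≤-trans x∧y≤x (≤-trans x∧y≤x x∧y≤x))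
    x≤b : x ≤ b
    x≤b = modus-ponens x≤a (≤-trans x∧y≤x x∧y≤y)
    x≤◇b : x ≤ ◇ b
    x≤◇b = modus-ponens x≤b (≤-trans x∧y≤x (≤-trans x∧y≤x x∧y≤y))

theorem5 : ∀ {c : Level} (B : BLAlgebra c) (□ ◇ : BLAlgebra.A B → BLAlgebra.A B)
           → IsGödel B → IsEpistemic B □ ◇ → IsBiModalGödel B □ ◇
theorem5 B □ ◇ gödel epistemic = record
  { G1  = □-∗
  ; G2  = E1
  ; G3  = ◇⇒□≤□⇒
  ; G4  = E8
  ; G5  = E2
  ; G6  = ◇⇒≤□⇒◇
  ; G7  = □≤◇
  ; G8a = □≤□□
  ; G8b = λ a → ≤-reflexive (sym (◇-idem a))
  ; G9a = ◇≤□◇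
  ; G9b = ◇□≤□
  }
  where
  open BLProperties B
  open IsEpistemic epistemic
  open EpistemicProperties B □ ◇ epistemic
  open EpistemicGödelProperties B □ ◇ gödel epistemic
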